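{- Let $d\ge 1$ and $m$ be positive integers and let $C=[0,m]^d\subset\mathbb{R}^d$. Then the minimum cardinality of a maximal system of cubic islands in $C$ is $g'_d(m)=m$.
   Context: A brick of $C$ is a set $[a_1,b_1]\times\cdots\times[a_d,b_d]$ with $a_i,b_i\in\mathbb{Z}$ and $0\le a_i<b_i\le m$. A system of brick islands in $C$ is a set $H$ of bricks of $C$ such that any two members are either nested (one contains the other) or disjoint. A system of cubic islands in $C$ is a system of brick islands in $C$ all of whose members are cubes (all side lengths equal). Let $I_C$ denote the set of systems of cubic islands in $C$ and $Max(I_C)$ its maximal elements with respect to inclusion. Define $g'_d(m)=\min\{|H|:H\in Max(I_C)\}$. -}

module Defs where

open import Data.Nat using (ℕ; _≤_; _<_; _∸_)
open import Data.Fin using (Fin)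
open import Data.Vec using (Vec; lookup)
open import Data.Product using (_×_; ∃)
open import Data.Sum using (_⊎_)
open import Data.List using (List; length)
open import Data.List.Membership.Propositional using (_∈_)
open import Data.List.Relation.Binary.Subset.Propositional using (_⊆_)
open import Data.List.Relation.Unary.All using (All)
open import Data.List.Relation.Unary.Unique.Propositional using (Unique)
open import Relation.Binary.PropositionalEquality using (_≡_)

-- A box [lo_1,hi_1] × ... × [lo_d,hi_d] with integer (here natural) endpoints.
record Brick (d : ℕ) : Set where
  constructor brick
  field
    lo : Vec ℕ d
    hi : Vec ℕ d
open Brick public

IsBrickOf : {d : ℕ} → ℕ → Brick d → Set
IsBrickOf {d} m B = (i : Fin d) → lookup (lo B) i < lookup (hi B) i × lookup (hi B) i ≤ m

IsCube : {d : ℕ} → Brick d → Set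
IsCube {d} B = (i j : Fin d) → lookup (hi B) i ∸ lookup (lo B) i ≡ lookup (hi B) j ∸ lookup (lo B) j

-- Set inclusion B ⊆ B' of (nonempty) closed boxes.
SubBrick : {d : ℕ} → Brick d → Brick d → Set
SubBrick {d} B B' = (i : Fin d) → lookup (lo B') i ≤ lookup (lo B) i × lookup (hi B) i ≤ lookup (hi B') i

Nested : {d : ℕ} → Brick d → Brick d → Set
Nested B B' = SubBrick B B' ⊎ SubBrick B' B

-- Disjointness of closed boxes as subsets of ℝ^d: some coordinate intervals are disjoint.
Disjoint : {d : ℕ} → Brick d → Brick d → Set
Disjoint {d} B B' = ∃ λ (i : Fin d) → lookup (hi B) i < lookup (lo B') i ⊎ lookup (hi B') i < lookup (lo B) i

-- A system of cubic islands in C = [0,m]^d, represented as a duplicate-free list (finite set).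
IsCubicSystem : (d m : ℕ) → List (Brick d) → Set
IsCubicSystem d m H =
  Unique H ×
  All (λ B → IsBrickOf m B × IsCube B) H ×
  (∀ {B B'} → B ∈ H → B' ∈ H → Nested B B' ⊎ Disjoint B B')

IsMaximalCubicSystem : (d m : ℕ) → List (Brick d) → Set
IsMaximalCubicSystem d m H =
  IsCubicSystem d m H ×
  (∀ (H' : List (Brick d)) → IsCubicSystem d m H' → H ⊆ H' → H' ⊆ H)

g'-is : (d m k : ℕ) → Set
g'-is d m k =
  (∃ λ (H : List (Brick d)) → IsMaximalCubicSystem d m H × length H ≡ k) ×
  (∀ (H : List (Brick d)) → IsMaximalCubicSystem d m H → k ≤ length H)

module Submission where

-- The chain [0,1]^d ⊂ [0,2]^d ⊂ … ⊂ [0,m]^d is a system of m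
-- nested cubes.  It is maximal: if a cube X is compatible with every
-- [0,j]^d, let j be the largest coordinate of its lower corner; comparing X
-- with [0,j]^d forces j = 0, so X = [0, side X]^d already lies in the chain.
--
-- Let H be maximal; every cube of C compatible with all of H
-- then lies in H, in particular [0,m]^d ∈ H.  For B ∈ H we label each
-- t < side B by a member of H inside B, injectively in t.  If t+1 = side B
-- the label is B itself.  Otherwise let P be the cube of side t+1 in the
-- lower corner of B, and let C be a largest member of H strictly inside B
-- that straddles P (contains P, or meets P without lying inside it); one
-- exists because P is in H or clashes with a member of H.  Such a C is a
-- maximal proper sub-island of B, so two different ones are disjoint, and
-- t lies in the window  o ≤ t < o + side C  where o is the offset of C
-- inside B; t receives the label of t ∸ o in C.  Injectivity follows from
-- the window inside one child and from disjointness across children.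
-- Labelling [0,m]^d injects {0,…,m-1} into H.

open import Defs
open import Data.Nat using (ℕ; zero; suc; _+_; _∸_; _≤_; _<_; z≤n; s≤s; _≤?_; _<?_; _⊔_; pred)
open import Data.Nat.Properties
open import Data.Fin using (Fin; toℕ)
import Data.Fin as Fin
open import Data.Fin.Properties using (all?; any?; toℕ-injective; toℕ<n; injective⇒≤)
open import Data.Vec using (Vec; lookup)
import Data.Vec as Vec
open import Data.Vec.Properties using (lookup-map; lookup-replicate; tabulate∘lookup; tabulate-cong; ≡-dec)
open import Data.Product using (∃; _×_; _,_; proj₁; proj₂; uncurry)
open import Data.Sum using (_⊎_; inj₁; inj₂)
open import Data.Empty using (⊥-elim)
open import Data.List using (List; []; _∷_; length; filter; applyUpTo)
import Data.List as List
open import Data.List.Properties using (length-applyUpTo)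
open import Data.List.Membership.Propositional using (_∈_; find)
open import Data.List.Membership.Propositional.Properties using (∈-filter⁺; ∈-filter⁻; ∈-applyUpTo⁺; ∈-applyUpTo⁻)
open import Data.List.Relation.Unary.Any using (here; there; index)
import Data.List.Relation.Unary.Any as Any
open import Data.List.Relation.Unary.Any.Properties using (lookup-index)
open import Data.List.Relation.Unary.All using (All; _∷_)
import Data.List.Relation.Unary.All as All
open import Data.List.Relation.Unary.All.Properties.Core using (¬Any⇒All¬; ¬All⇒Any¬)
open import Data.List.Relation.Unary.AllPairs using (_∷_)
open import Data.List.Relation.Unary.Unique.Propositional.Properties using (applyUpTo⁺₁)
open import Data.List.Relation.Binary.Subset.Propositional using (_⊆_)
open import Data.List.Extrema.Nat using (argmax; argmax-sel; f[⊥]≤f[argmax]; f[xs]≤f[argmax])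
open import Relation.Nullary using (¬_; Dec; yes; no)
open import Relation.Nullary.Decidable using (_×-dec_; _⊎-dec_; ¬?; map′)
open import Relation.Binary.PropositionalEquality

maxOver : ∀ {k} → (Fin k → ℕ) → ℕ
maxOver {zero}  f = 0
maxOver {suc k} f = f Fin.zero ⊔ maxOver (λ i → f (Fin.suc i))

maxOver-ub : ∀ {k} (f : Fin k → ℕ) i → f i ≤ maxOver f
maxOver-ub f Fin.zero    = m≤m⊔n _ _
maxOver-ub f (Fin.suc i) = ≤-trans (maxOver-ub (λ j → f (Fin.suc j)) i) (m≤n⊔m _ _)

maxOver-lub : ∀ {k} (f : Fin k → ℕ) {x} → (∀ i → f i ≤ x) → maxOver f ≤ x
maxOver-lub {zero}  f h = z≤n
maxOver-lub {suc k} f h = ⊔-lub (h Fin.zero) (maxOver-lub (λ i → f (Fin.suc i)) (λ i → h (Fin.suc i)))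

≤suc-pred : ∀ n → n ≤ suc (pred n)
≤suc-pred zero    = z≤n
≤suc-pred (suc n) = ≤-refl

Vec-ext : ∀ {k} {xs ys : Vec ℕ k} → (∀ i → lookup xs i ≡ lookup ys i) → xs ≡ ys
Vec-ext {xs = xs} {ys} h = trans (sym (tabulate∘lookup xs)) (trans (tabulate-cong h) (tabulate∘lookup ys))

largest : {A : Set} → (A → ℕ) → A → List A → A
largest f a []       = a
largest f a (x ∷ xs) = argmax f x xs

largest-spec : {A : Set} (f : A → ℕ) (a : A) {L : List A} {x : A} → x ∈ L →
               largest f a L ∈ L × (∀ {y} → y ∈ L → f y ≤ f (largest f a L))
largest-spec f a {x ∷ xs} _ = member (argmax-sel f x xs) , bound
  where
  member : argmax f x xs ≡ x ⊎ argmax f x xs ∈ xs → argmax f x xs ∈ x ∷ xs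
  member (inj₁ eq) = here eq
  member (inj₂ m)  = there m
  bound : ∀ {y} → y ∈ x ∷ xs → f y ≤ f (argmax f x xs)
  bound (here refl) = f[⊥]≤f[argmax] {f = f} x xs
  bound (there m)   = All.lookup (f[xs]≤f[argmax] {f = f} x xs) m

injection-into-list : {A : Set} {k : ℕ} (L : List A) (f : Fin k → A) →
                      (∀ i → f i ∈ L) → (∀ {i j} → f i ≡ f j → i ≡ j) → k ≤ length L
injection-into-list L f f∈L f-inj = injective⇒≤ position-injective
  where
  position-injective : ∀ {i j} → index (f∈L i) ≡ index (f∈L j) → i ≡ j
  position-injective {i} {j} eq = f-inj (begin
    f i                         ≡⟨ lookup-index (f∈L i) ⟩
    List.lookup L (index (f∈L i)) ≡⟨ cong (List.lookup L) eq ⟩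
    List.lookup L (index (f∈L j)) ≡⟨ lookup-index (f∈L j) ⟨
    f j                         ∎)
    where open ≡-Reasoning

module _ {d : ℕ} where

  low high : Brick d → Fin d → ℕ
  low B  = lookup (lo B)
  high B = lookup (hi B)

  -- Inclusion of bricks, wrapped in a record so that the bricks can be
  -- inferred from an inclusion proof.
  infix 4 _⊑_
  record _⊑_ (X Y : Brick d) : Set where
    constructor within
    field
      coordinatewise : SubBrick X Y

    ⊑-low : ∀ k → low Y k ≤ low X k
    ⊑-low k = proj₁ (coordinatewise k)

    ⊑-high : ∀ k → high X k ≤ high Y k
    ⊑-high k = proj₂ (coordinatewise k)
  open _⊑_ public

  Compatible : Brick d → Brick d → Set
  Compatible X Y = (X ⊑ Y ⊎ Y ⊑ X) ⊎ Disjoint X Y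

  compatible⁺ : ∀ {X Y : Brick d} → Nested X Y ⊎ Disjoint X Y → Compatible X Y
  compatible⁺ (inj₁ (inj₁ s)) = inj₁ (inj₁ (within s))
  compatible⁺ (inj₁ (inj₂ s)) = inj₁ (inj₂ (within s))
  compatible⁺ (inj₂ dj)       = inj₂ dj

  compatible⁻ : ∀ {X Y : Brick d} → Compatible X Y → Nested X Y ⊎ Disjoint X Y
  compatible⁻ (inj₁ (inj₁ s)) = inj₁ (inj₁ (coordinatewise s))
  compatible⁻ (inj₁ (inj₂ s)) = inj₁ (inj₂ (coordinatewise s))
  compatible⁻ (inj₂ dj)       = inj₂ dj

  Straddles : Brick d → Brick d → Set
  Straddles X P = P ⊑ X ⊎ (¬ Disjoint X P × ¬ X ⊑ P)

  ⊑-refl : ∀ {X : Brick d} → X ⊑ X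
  ⊑-refl = within (λ k → ≤-refl , ≤-refl)

  ⊑-trans : ∀ {X Y Z : Brick d} → X ⊑ Y → Y ⊑ Z → X ⊑ Z
  ⊑-trans p q = within (λ k → ≤-trans (⊑-low q k) (⊑-low p k) , ≤-trans (⊑-high p k) (⊑-high q k))

  ⊑-antisym : ∀ {X Y : Brick d} → X ⊑ Y → Y ⊑ X → X ≡ Y
  ⊑-antisym {brick _ _} {brick _ _} p q =
    cong₂ brick (Vec-ext (λ k → ≤-antisym (⊑-low q k) (⊑-low p k)))
                (Vec-ext (λ k → ≤-antisym (⊑-high p k) (⊑-high q k)))

  Disjoint-sym : ∀ {X Y : Brick d} → Disjoint X Y → Disjoint Y X
  Disjoint-sym (k , inj₁ gap) = k , inj₂ gap
  Disjoint-sym (k , inj₂ gap) = k , inj₁ gap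

  Disjoint-shrinkʳ : ∀ {X Y Y' : Brick d} → Y' ⊑ Y → Disjoint X Y → Disjoint X Y'
  Disjoint-shrinkʳ s (k , inj₁ gap) = k , inj₁ (<-≤-trans gap (⊑-low s k))
  Disjoint-shrinkʳ s (k , inj₂ gap) = k , inj₂ (≤-<-trans (⊑-high s k) gap)

  Disjoint-shrinkˡ : ∀ {X X' Y : Brick d} → X' ⊑ X → Disjoint X Y → Disjoint X' Y
  Disjoint-shrinkˡ {X} {X'} {Y} s dj =
    Disjoint-sym {X = Y} {Y = X'} (Disjoint-shrinkʳ {X = Y} s (Disjoint-sym {X = X} {Y = Y} dj))

  Compatible-sym : ∀ {X Y : Brick d} → Compatible X Y → Compatible Y X
  Compatible-sym (inj₁ (inj₁ s))     = inj₁ (inj₂ s)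
  Compatible-sym (inj₁ (inj₂ s))     = inj₁ (inj₁ s)
  Compatible-sym {X} {Y} (inj₂ dj) = inj₂ (Disjoint-sym {X = X} {Y = Y} dj)

  clash⇒Straddles : ∀ {X P : Brick d} → ¬ Compatible X P → Straddles X P
  clash⇒Straddles clash = inj₂ ((λ dj → clash (inj₂ dj)) , (λ s → clash (inj₁ (inj₁ s))))

  Straddles-up : ∀ {X Z P : Brick d} → X ⊑ Z → Straddles X P → Straddles Z P
  Straddles-up X⊑Z (inj₁ P⊑X)          = inj₁ (⊑-trans P⊑X X⊑Z)
  Straddles-up {P = P} X⊑Z (inj₂ (meet , out)) =
    inj₂ ((λ dj → meet (Disjoint-shrinkˡ {Y = P} X⊑Z dj)) , (λ Z⊑P → out (⊑-trans X⊑Z Z⊑P)))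

  _⊑?_ : ∀ X Y → Dec (X ⊑ Y)
  X ⊑? Y = map′ within coordinatewise (all? (λ k → (low Y k ≤? low X k) ×-dec (high X k ≤? high Y k)))

  Disjoint? : ∀ X Y → Dec (Disjoint X Y)
  Disjoint? X Y = any? (λ k → (high X k <? low Y k) ⊎-dec (high Y k <? low X k))

  Compatible? : ∀ X Y → Dec (Compatible X Y)
  Compatible? X Y = ((X ⊑? Y) ⊎-dec (Y ⊑? X)) ⊎-dec Disjoint? X Y

  Straddles? : ∀ X P → Dec (Straddles X P)
  Straddles? X P = (P ⊑? X) ⊎-dec (¬? (Disjoint? X P) ×-dec ¬? (X ⊑? P))

  _≟B_ : ∀ (X Y : Brick d) → Dec (X ≡ Y)
  brick a b ≟B brick c e with ≡-dec _≟_ a c | ≡-dec _≟_ b e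
  ... | yes refl | yes refl = yes refl
  ... | no a≢c   | _        = no (λ { refl → a≢c refl })
  ... | yes _    | no b≢e   = no (λ { refl → b≢e refl })

-- Cubes of C = [0,m]^d for d = suc n (one coordinate is needed to read off the side).
module Cubes (n m : ℕ) where

  d : ℕ
  d = suc n

  Br : Set
  Br = Brick d

  -- B is a cube of C (a record, so that B can be inferred from the proof).
  record Good (B : Br) : Set where
    constructor good
    field
      brick-of-C : IsBrickOf m B
      cubic      : IsCube B

    lo<hi : ∀ k → low B k < high B k
    lo<hi k = proj₁ (brick-of-C k)

    hi≤m : ∀ k → high B k ≤ m
    hi≤m k = proj₂ (brick-of-C k)
  open Good public

  side : Br → ℕ
  side B = high B Fin.zero ∸ low B Fin.zero

  hi≡lo+side : ∀ {B} → Good B → ∀ k → high B k ≡ low B k + side B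
  hi≡lo+side {B} g k = begin
    high B k                     ≡⟨ m∸n+n≡m (<⇒≤ (lo<hi g k)) ⟨
    (high B k ∸ low B k) + low B k ≡⟨ cong (_+ low B k) (cubic g k Fin.zero) ⟩
    side B + low B k             ≡⟨ +-comm (side B) (low B k) ⟩
    low B k + side B             ∎
    where open ≡-Reasoning

  1≤side : ∀ {B} → Good B → 1 ≤ side B
  1≤side g = m<n⇒0<n∸m (lo<hi g Fin.zero)

  good-by-corner : ∀ {B} → 1 ≤ side B →
                   (∀ k → high B k ≡ low B k + side B) → (∀ k → high B k ≤ m) → Good B
  good-by-corner {B} 1≤s hi≡ hi≤ =
    good (λ k → subst (low B k <_) (sym (hi≡ k)) (m<m+n (low B k) 1≤s) , hi≤ k)
         (λ i j → trans (width i) (sym (width j)))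
    where
    width : ∀ k → high B k ∸ low B k ≡ side B
    width k = trans (cong (_∸ low B k) (hi≡ k)) (m+n∸m≡n (low B k) (side B))

  side-mono : ∀ {X Y} → X ⊑ Y → side X ≤ side Y
  side-mono s = ∸-mono (⊑-high s Fin.zero) (⊑-low s Fin.zero)

  ⊑-same-side : ∀ {X Y} → Good X → Good Y → X ⊑ Y → side X ≡ side Y → X ≡ Y
  ⊑-same-side {X} {Y} gX gY X⊑Y eq = ⊑-antisym X⊑Y (within (λ k → lowY≤lowX k , highX≤highY k))
    where
    hiY : ∀ k → high Y k ≡ low Y k + side X
    hiY k = trans (hi≡lo+side gY k) (cong (low Y k +_) (sym eq))
    lowY≤lowX : ∀ k → low X k ≤ low Y k
    lowY≤lowX k = +-cancelʳ-≤ (side X) (low X k) (low Y k)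
                    (subst₂ _≤_ (hi≡lo+side gX k) (hiY k) (⊑-high X⊑Y k))
    highX≤highY : ∀ k → high Y k ≤ high X k
    highX≤highY k = subst₂ _≤_ (sym (hiY k)) (sym (hi≡lo+side gX k)) (+-monoˡ-≤ (side X) (⊑-low X⊑Y k))

  ⊏⇒side< : ∀ {X Y} → Good X → Good Y → X ⊑ Y → X ≢ Y → side X < side Y
  ⊏⇒side< gX gY X⊑Y X≢Y = ≤∧≢⇒< (side-mono X⊑Y) (λ eq → X≢Y (⊑-same-side gX gY X⊑Y eq))

  common-subcube : ∀ {X A B} → Good X → X ⊑ A → X ⊑ B → ¬ Disjoint A B
  common-subcube gX X⊑A X⊑B (k , inj₁ gap) =
    <-irrefl refl (<-≤-trans (<-trans (<-≤-trans gap (⊑-low X⊑B k)) (lo<hi gX k)) (⊑-high X⊑A k))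
  common-subcube gX X⊑A X⊑B (k , inj₂ gap) =
    <-irrefl refl (<-≤-trans (<-trans (<-≤-trans gap (⊑-low X⊑A k)) (lo<hi gX k)) (⊑-high X⊑B k))

  corner : Br → ℕ → Br
  corner B s = brick (lo B) (Vec.map (_+ s) (lo B))

  corner-high : ∀ B s k → high (corner B s) k ≡ low B k + s
  corner-high B s k = lookup-map k (_+ s) (lo B)

  corner-side : ∀ B s → side (corner B s) ≡ s
  corner-side B s = trans (cong (_∸ low B Fin.zero) (corner-high B s Fin.zero)) (m+n∸m≡n (low B Fin.zero) s)

  corner⊑ : ∀ {B} s → Good B → s ≤ side B → corner B s ⊑ B
  corner⊑ {B} s g s≤ =
    within (λ k → ≤-refl , subst₂ _≤_ (sym (corner-high B s k)) (sym (hi≡lo+side g k))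
                                       (+-monoʳ-≤ (low B k) s≤))

  corner-good : ∀ {B} s → Good B → 1 ≤ s → s ≤ side B → Good (corner B s)
  corner-good {B} s g 1≤s s≤ =
    good-by-corner (subst (1 ≤_) (sym (corner-side B s)) 1≤s)
                   (λ k → trans (corner-high B s k) (cong (low B k +_) (sym (corner-side B s))))
                   (λ k → ≤-trans (⊑-high (corner⊑ s g s≤) k) (hi≤m g k))

  cube₀ : ℕ → Br
  cube₀ j = brick (Vec.replicate d 0) (Vec.replicate d j)

  cube₀-low : ∀ j k → low (cube₀ j) k ≡ 0
  cube₀-low j k = lookup-replicate k 0

  cube₀-high : ∀ j k → high (cube₀ j) k ≡ j
  cube₀-high j k = lookup-replicate k j

  cube₀-side : ∀ j → side (cube₀ j) ≡ j
  cube₀-side j = cong₂ _∸_ (cube₀-high j Fin.zero) (cube₀-low j Fin.zero)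

  cube₀-good : ∀ {j} → 1 ≤ j → j ≤ m → Good (cube₀ j)
  cube₀-good {j} 1≤j j≤m =
    good-by-corner (subst (1 ≤_) (sym (cube₀-side j)) 1≤j)
                   (λ k → trans (cube₀-high j k) (sym (cong₂ _+_ (cube₀-low j k) (cube₀-side j))))
                   (λ k → subst (_≤ m) (sym (cube₀-high j k)) j≤m)

  cube₀-mono : ∀ {i j} → i ≤ j → cube₀ i ⊑ cube₀ j
  cube₀-mono {i} {j} i≤j = within (λ k → ≤-reflexive (trans (cube₀-low j k) (sym (cube₀-low i k)))
                                       , subst₂ _≤_ (sym (cube₀-high i k)) (sym (cube₀-high j k)) i≤j)

  ⊑C : ∀ {X} → Good X → X ⊑ cube₀ m
  ⊑C {X} g = within (λ k → subst (_≤ low X k) (sym (cube₀-low m k)) z≤n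
                         , subst (high X k ≤_) (sym (cube₀-high m k)) (hi≤m g k))

  shift : Br → Br → Fin d → ℕ
  shift B C k = low C k ∸ low B k

  offset : Br → Br → ℕ
  offset B C = pred (maxOver (shift B C))

  window : ∀ {B C} t → Good C → C ⊑ B → Straddles C (corner B (suc t)) →
           offset B C ≤ t × t < offset B C + side C
  -- C contains P: then C has offset 0 and side at least t+1.
  window {B} {C} t gC C⊑B (inj₁ P⊑C) = offset≤t , t<window
    where
    shift≤0 : maxOver (shift B C) ≤ 0
    shift≤0 = maxOver-lub (shift B C) (λ k → ≤-reflexive (m≤n⇒m∸n≡0 (⊑-low P⊑C k)))
    offset≤t : offset B C ≤ t
    offset≤t = ≤-trans (pred-mono-≤ shift≤0) z≤n
    t<window : t < offset B C + side C
    t<window = ≤-trans (subst (_≤ side C) (corner-side B (suc t)) (side-mono P⊑C))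
                       (m≤n+m (side C) (offset B C))
  -- C meets P without lying inside it: each lower coordinate of C is within
  -- t+1 of that of B (else C and P are disjoint), and were t beyond the
  -- window, C would fit inside P.
  window {B} {C} t gC C⊑B (inj₂ (meet , outside)) = pred-mono-≤ shift≤ , t<window
    where
    P = corner B (suc t)
    M : ℕ
    M = maxOver (shift B C)
    reach : ∀ k → low C k ≤ low B k + suc t
    reach k with low C k ≤? high P k
    ... | yes le = subst (low C k ≤_) (corner-high B (suc t) k) le
    ... | no nle = ⊥-elim (meet (k , inj₂ (≰⇒> nle)))
    shift≤ : M ≤ suc t
    shift≤ = maxOver-lub (shift B C) (λ k → m≤n+o⇒m∸n≤o (low C k) (low B k) (reach k))
    below-shift : ∀ k → low C k ≤ low B k + M
    below-shift k = ≤-trans (m≤n+m∸n (low C k) (low B k)) (+-monoʳ-≤ (low B k) (maxOver-ub (shift B C) k))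
    fits : offset B C + side C ≤ t → C ⊑ P
    fits le = within (λ k → ⊑-low C⊑B k , (begin
      high C k                           ≡⟨ hi≡lo+side gC k ⟩
      low C k + side C                   ≤⟨ +-monoˡ-≤ (side C) (below-shift k) ⟩
      (low B k + M) + side C             ≡⟨ +-assoc (low B k) M (side C) ⟩
      low B k + (M + side C)             ≤⟨ +-monoʳ-≤ (low B k) (+-monoˡ-≤ (side C) (≤suc-pred M)) ⟩
      low B k + suc (offset B C + side C) ≤⟨ +-monoʳ-≤ (low B k) (s≤s le) ⟩
      low B k + suc t                    ≡⟨ corner-high B (suc t) k ⟨
      high P k                           ∎))
      where open ≤-Reasoning
    t<window : t < offset B C + side C
    t<window with offset B C + side C ≤? t
    ... | yes le = ⊥-elim (outside (fits le))
    ... | no nle = ≰⇒> nle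

module Chain (n m : ℕ) where
  open Cubes n m

  chain : List Br
  chain = applyUpTo (λ i → cube₀ (suc i)) m

  ∈-chain⁻ : ∀ {X} → X ∈ chain → ∃ λ j → 1 ≤ j × j ≤ m × X ≡ cube₀ j
  ∈-chain⁻ X∈ with ∈-applyUpTo⁻ (λ i → cube₀ (suc i)) X∈
  ... | i , i<m , refl = suc i , s≤s z≤n , i<m , refl

  ∈-chain⁺ : ∀ {j} → 1 ≤ j → j ≤ m → cube₀ j ∈ chain
  ∈-chain⁺ {suc i} _ j≤m = ∈-applyUpTo⁺ (λ i → cube₀ (suc i)) j≤m

  chain-system : IsCubicSystem d m chain
  chain-system = applyUpTo⁺₁ _ m distinct
               , All.tabulate (λ X∈ → brick-of-C (member-good X∈) , cubic (member-good X∈))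
               , λ X∈ Y∈ → compatible⁻ (compatible X∈ Y∈)
    where
    distinct : ∀ {i j} → i < j → j < m → cube₀ (suc i) ≢ cube₀ (suc j)
    distinct {i} {j} i<j _ eq = <-irrefl (suc-injective (trans (sym (cube₀-side (suc i)))
                                  (trans (cong side eq) (cube₀-side (suc j))))) i<j
    member-good : ∀ {X} → X ∈ chain → Good X
    member-good X∈ with ∈-chain⁻ X∈
    ... | j , 1≤j , j≤m , refl = cube₀-good 1≤j j≤m
    compatible : ∀ {X Y} → X ∈ chain → Y ∈ chain → Compatible X Y
    compatible X∈ Y∈ with ∈-chain⁻ X∈ | ∈-chain⁻ Y∈
    ... | i , _ , _ , refl | j , _ , _ , refl with ≤-total i j
    ...   | inj₁ i≤j = inj₁ (inj₁ (cube₀-mono i≤j))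
    ...   | inj₂ j≤i = inj₁ (inj₂ (cube₀-mono j≤i))

  based-at-0 : ∀ {X} → Good X → (∀ k → low X k ≡ 0) → X ≡ cube₀ (side X)
  based-at-0 {X} g low≡0 =
    cong₂ brick (Vec-ext (λ k → trans (low≡0 k) (sym (cube₀-low (side X) k))))
                (Vec-ext (λ k → trans (hi≡lo+side g k)
                                  (trans (cong (_+ side X) (low≡0 k)) (sym (cube₀-high (side X) k)))))

  compatible⇒∈chain : ∀ {X} → Good X → (∀ {j} → 1 ≤ j → j ≤ m → Compatible X (cube₀ j)) → X ∈ chain
  compatible⇒∈chain {X} g compat = by-max-corner (maxOver (low X)) refl
    where
    M≤m : maxOver (low X) ≤ m
    M≤m = maxOver-lub (low X) (λ k → ≤-trans (<⇒≤ (lo<hi g k)) (hi≤m g k))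
    side≤m : side X ≤ m
    side≤m = ≤-trans (m∸n≤m (high X Fin.zero) (low X Fin.zero)) (hi≤m g Fin.zero)
    by-max-corner : ∀ M → maxOver (low X) ≡ M → X ∈ chain
    by-max-corner zero M≡0 =
      subst (_∈ chain) (sym (based-at-0 g (λ k → n≤0⇒n≡0 (subst (low X k ≤_) M≡0 (maxOver-ub (low X) k)))))
            (∈-chain⁺ (1≤side g) side≤m)
    by-max-corner (suc M') M≡ with compat (s≤s z≤n) (subst (_≤ m) M≡ M≤m)
    -- X ⊑ [0,M]^d: every lower coordinate is below an upper one ≤ M, so the maximum is < M.
    ... | inj₁ (inj₁ X⊑) = ⊥-elim (1+n≰n (subst (_≤ M') M≡ (maxOver-lub (low X)
            (λ k → ≤-pred (<-≤-trans (lo<hi g k) (subst (high X k ≤_) (cube₀-high (suc M') k) (⊑-high X⊑ k)))))))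
    -- [0,M]^d ⊑ X: every lower coordinate is 0, so the maximum is 0 < M.
    ... | inj₁ (inj₂ ⊑X) = ⊥-elim (1+n≰n (≤-trans (subst (_≤ 0) M≡ (maxOver-lub (low X)
            (λ k → subst (low X k ≤_) (cube₀-low (suc M') k) (⊑-low ⊑X k)))) z≤n))
    -- Disjointness fails: no upper coordinate of X is < 0, and no lower one is > M.
    ... | inj₂ (k , inj₁ gap) = ⊥-elim (n≮0 (subst (high X k <_) (cube₀-low (suc M') k) gap))
    ... | inj₂ (k , inj₂ gap) = ⊥-elim (<-irrefl refl (<-≤-trans (subst (_< low X k) (cube₀-high (suc M') k) gap)
                                                               (subst (low X k ≤_) M≡ (maxOver-ub (low X) k))))

  -- Any system containing the chain consists of cubes compatible with the whole chain.
  chain-maximal : IsMaximalCubicSystem d m chain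
  chain-maximal = chain-system , λ H' (_ , good' , compat') chain⊆H' X∈H' →
    compatible⇒∈chain (uncurry good (All.lookup good' X∈H'))
                      (λ 1≤j j≤m → compatible⁺ (compat' X∈H' (chain⊆H' (∈-chain⁺ 1≤j j≤m))))

  chain-length : length chain ≡ m
  chain-length = length-applyUpTo _ m

module LowerBound (n m : ℕ) (H : List (Brick (suc n)))
                  (system : IsCubicSystem (suc n) m H)
                  (maximal : ∀ H' → IsCubicSystem (suc n) m H' → H ⊆ H' → H' ⊆ H) where
  open Cubes n m

  member-good : ∀ {X} → X ∈ H → Good X
  member-good X∈ = uncurry good (All.lookup (proj₁ (proj₂ system)) X∈)

  member-compatible : ∀ {X Y} → X ∈ H → Y ∈ H → Compatible X Y
  member-compatible X∈ Y∈ = compatible⁺ (proj₂ (proj₂ system) X∈ Y∈)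

  saturated : ∀ {P} → Good P → (∀ {X} → X ∈ H → Compatible X P) → P ∈ H
  saturated {P} gP compat with Any.any? (P ≟B_) H
  ... | yes P∈H = P∈H
  ... | no  P∉H = maximal (P ∷ H) extended there (here refl)
    where
    compat' : ∀ {X Y} → X ∈ P ∷ H → Y ∈ P ∷ H → Compatible X Y
    compat' (here refl) (here refl) = inj₁ (inj₁ ⊑-refl)
    compat' (here refl) (there Y∈) = Compatible-sym (compat Y∈)
    compat' (there X∈)  (here refl) = compat X∈
    compat' (there X∈)  (there Y∈) = member-compatible X∈ Y∈
    extended : IsCubicSystem d m (P ∷ H)
    extended = (¬Any⇒All¬ H P∉H ∷ proj₁ system) , ((brick-of-C gP , cubic gP) ∷ proj₁ (proj₂ system))
             , λ X∈ Y∈ → compatible⁻ (compat' X∈ Y∈)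

  C∈H : 1 ≤ m → cube₀ m ∈ H
  C∈H 1≤m = saturated (cube₀-good 1≤m ≤-refl) (λ X∈ → inj₁ (inj₁ (⊑C (member-good X∈))))

  blocker : ∀ {P} → Good P → ∃ λ Y → Y ∈ H × (Y ≡ P ⊎ ¬ Compatible Y P)
  blocker {P} gP with All.all? (λ X → Compatible? X P) H
  ... | yes compat = P , saturated gP (All.lookup compat) , inj₁ refl
  ... | no  ¬compat with find (¬All⇒Any¬ (λ X → Compatible? X P) H ¬compat)
  ...   | Y , Y∈ , clash = Y , Y∈ , inj₂ clash

  Candidate : Br → Br → Br → Set
  Candidate B P Z = Straddles Z P × Z ⊑ B × Z ≢ B

  candidate? : ∀ B P Z → Dec (Candidate B P Z)
  candidate? B P Z = Straddles? Z P ×-dec (Z ⊑? B) ×-dec ¬? (Z ≟B B)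

  candidate-exists : ∀ {B P} → B ∈ H → Good P → P ⊑ B → side P < side B → ∃ λ Y → Y ∈ H × Candidate B P Y
  candidate-exists {B} {P} B∈ gP P⊑B P<B with blocker gP
  ... | _ , P∈ , inj₁ refl = P , P∈ , inj₁ ⊑-refl , P⊑B , λ P≡B → <-irrefl (cong side P≡B) P<B
  ... | Y , Y∈ , inj₂ clash = Y , Y∈ , clash⇒Straddles clash , Y⊑B (member-compatible Y∈ B∈) , Y≢B
    where
    Y⊑B : Compatible Y B → Y ⊑ B
    Y⊑B (inj₁ (inj₁ Y⊑B)) = Y⊑B
    Y⊑B (inj₁ (inj₂ B⊑Y)) = ⊥-elim (clash (inj₁ (inj₂ (⊑-trans P⊑B B⊑Y))))
    Y⊑B (inj₂ dj)         = ⊥-elim (clash (inj₂ (Disjoint-shrinkʳ {X = Y} P⊑B dj)))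
    Y≢B : Y ≢ B
    Y≢B refl = clash (inj₁ (inj₂ P⊑B))

  -- The child of B responsible for t: a largest candidate for the corner cube of side t+1.
  -- Only child-spec is used about it, so it is kept opaque.
  opaque
    child : Br → ℕ → Br
    child B t = largest side B (filter (candidate? B (corner B (suc t))) H)

    child-spec : ∀ {B t} → B ∈ H → suc t < side B →
                 child B t ∈ H × Candidate B (corner B (suc t)) (child B t) ×
                 (∀ {Z} → Z ∈ H → Candidate B (corner B (suc t)) Z → side Z ≤ side (child B t))
    child-spec {B} {t} B∈ t+1<side =
      proj₁ (∈-filter⁻ cand? {xs = H} C∈) , proj₂ (∈-filter⁻ cand? {xs = H} C∈)
      , λ Z∈ candZ → largest-side (∈-filter⁺ cand? Z∈ candZ)
      where
      P : Br
      P = corner B (suc t)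
      cand? : ∀ Z → Dec (Candidate B P Z)
      cand? = candidate? B P
      gB : Good B
      gB = member-good B∈
      some-candidate : ∃ λ Y → Y ∈ H × Candidate B P Y
      some-candidate = candidate-exists B∈ (corner-good (suc t) gB (s≤s z≤n) (<⇒≤ t+1<side))
                         (corner⊑ (suc t) gB (<⇒≤ t+1<side))
                         (subst (_< side B) (sym (corner-side B (suc t))) t+1<side)
      spec : child B t ∈ filter cand? H × (∀ {Z} → Z ∈ filter cand? H → side Z ≤ side (child B t))
      spec = largest-spec side B
               (∈-filter⁺ cand? (proj₁ (proj₂ some-candidate)) (proj₂ (proj₂ some-candidate)))
      C∈ : child B t ∈ filter cand? H
      C∈ = proj₁ spec
      largest-side : ∀ {Z} → Z ∈ filter cand? H → side Z ≤ side (child B t)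
      largest-side = proj₂ spec

  child-maximal : ∀ {B t Z} → B ∈ H → suc t < side B → Z ∈ H →
                  child B t ⊑ Z → Z ⊑ B → Z ≢ B → Z ≡ child B t
  child-maximal B∈ t+1<side Z∈ C⊑Z Z⊑B Z≢B with child-spec B∈ t+1<side
  ... | C∈ , (straddles , _) , largest-side =
    sym (⊑-same-side (member-good C∈) (member-good Z∈) C⊑Z
          (≤-antisym (side-mono C⊑Z) (largest-side Z∈ (Straddles-up C⊑Z straddles , Z⊑B , Z≢B))))

  children-disjoint : ∀ {B t₁ t₂} → B ∈ H → suc t₁ < side B → suc t₂ < side B →
                      child B t₁ ≢ child B t₂ → Disjoint (child B t₁) (child B t₂)
  children-disjoint B∈ q₁ q₂ C₁≢C₂ with child-spec B∈ q₁ | child-spec B∈ q₂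
  ... | C₁∈ , (_ , C₁⊑B , C₁≢B) , _ | C₂∈ , (_ , C₂⊑B , C₂≢B) , _ with member-compatible C₁∈ C₂∈
  ...   | inj₁ (inj₁ C₁⊑C₂) = ⊥-elim (C₁≢C₂ (sym (child-maximal B∈ q₁ C₂∈ C₁⊑C₂ C₂⊑B C₂≢B)))
  ...   | inj₁ (inj₂ C₂⊑C₁) = ⊥-elim (C₁≢C₂ (child-maximal B∈ q₂ C₁∈ C₂⊑C₁ C₁⊑B C₁≢B))
  ...   | inj₂ dj = dj

  child-window : ∀ {B t} → B ∈ H → suc t < side B →
                 offset B (child B t) ≤ t × t < offset B (child B t) + side (child B t)
  child-window {B} {t} B∈ t+1<side with child-spec B∈ t+1<side
  ... | C∈ , (straddles , C⊑B , _) , _ = window {B} {child B t} t (member-good C∈) C⊑B straddles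

  -- The label of t in B; the fuel k ≥ side B bounds the depth of the recursion.
  label : ℕ → Br → ℕ → Br
  label zero    B t = B
  label (suc k) B t with suc t <? side B
  ... | yes _ = label k (child B t) (t ∸ offset B (child B t))
  ... | no  _ = B

  module Step {k B t} (B∈ : B ∈ H) (side≤ : side B ≤ suc k) (t+1<side : suc t < side B) where
    C : Br
    C = child B t

    u : ℕ
    u = t ∸ offset B C

    C∈ : C ∈ H
    C∈ = proj₁ (child-spec B∈ t+1<side)

    C⊑B : C ⊑ B
    C⊑B = proj₁ (proj₂ (proj₁ (proj₂ (child-spec B∈ t+1<side))))

    C≢B : C ≢ B
    C≢B = proj₂ (proj₂ (proj₁ (proj₂ (child-spec B∈ t+1<side))))

    side-C≤k : side C ≤ k
    side-C≤k = ≤-pred (<-≤-trans (⊏⇒side< (member-good C∈) (member-good B∈) C⊑B C≢B) side≤)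

    offset≤t : offset B C ≤ t
    offset≤t = proj₁ (child-window B∈ t+1<side)

    u<side : u < side C
    u<side = <-≤-trans (∸-monoˡ-< (proj₂ (child-window B∈ t+1<side)) offset≤t)
                       (≤-reflexive (m+n∸m≡n (offset B C) (side C)))

  label-inside : ∀ k {B} → B ∈ H → side B ≤ k → ∀ {t} → t < side B → label k B t ∈ H × label k B t ⊑ B
  label-inside zero    B∈ side≤0 t<side = ⊥-elim (n≮0 (<-≤-trans t<side side≤0))
  label-inside (suc k) {B} B∈ side≤ {t} t<side with suc t <? side B
  ... | no  _        = B∈ , ⊑-refl
  ... | yes t+1<side = proj₁ inside-C , ⊑-trans (proj₂ inside-C) C⊑B
    where
    open Step B∈ side≤ t+1<side
    inside-C = label-inside k C∈ side-C≤k u<side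

  -- A label obtained through a child is not B itself, since it lies in the child.
  label-from-child≢B : ∀ {k B t} → B ∈ H → side B ≤ suc k → (q : suc t < side B) →
                       label k (child B t) (t ∸ offset B (child B t)) ≢ B
  label-from-child≢B B∈ side≤ q eq =
    C≢B (⊑-antisym C⊑B (subst (_⊑ C) eq (proj₂ (label-inside _ C∈ side-C≤k u<side))))
    where open Step B∈ side≤ q

  -- Labels obtained through different children differ, as the children are disjoint.
  children-labels-differ : ∀ {k B t₁ t₂} → B ∈ H → side B ≤ suc k →
                           (q₁ : suc t₁ < side B) (q₂ : suc t₂ < side B) → child B t₁ ≢ child B t₂ →
                           label k (child B t₁) (t₁ ∸ offset B (child B t₁))
                             ≢ label k (child B t₂) (t₂ ∸ offset B (child B t₂))
  children-labels-differ {k} B∈ side≤ q₁ q₂ C₁≢C₂ eq =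
    common-subcube (member-good (proj₁ inside₁)) (proj₂ inside₁)
                   (subst (_⊑ S₂.C) (sym eq) (proj₂ inside₂)) (children-disjoint B∈ q₁ q₂ C₁≢C₂)
    where
    module S₁ = Step B∈ side≤ q₁
    module S₂ = Step B∈ side≤ q₂
    inside₁ = label-inside k S₁.C∈ S₁.side-C≤k S₁.u<side
    inside₂ = label-inside k S₂.C∈ S₂.side-C≤k S₂.u<side

  window-injective : ∀ {B t₁ t₂} → B ∈ H → (q₁ : suc t₁ < side B) (q₂ : suc t₂ < side B) →
                     child B t₁ ≡ child B t₂ →
                     t₁ ∸ offset B (child B t₁) ≡ t₂ ∸ offset B (child B t₂) → t₁ ≡ t₂
  window-injective {B} {t₁} {t₂} B∈ q₁ q₂ C₁≡C₂ same-index =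
    ∸-cancelʳ-≡ (proj₁ (child-window B∈ q₁)) (subst (_≤ t₂) (sym offsets) (proj₁ (child-window B∈ q₂)))
                (trans same-index (cong (t₂ ∸_) (sym offsets)))
    where
    offsets : offset B (child B t₁) ≡ offset B (child B t₂)
    offsets = cong (offset B) C₁≡C₂

  label-injective : ∀ k {B} → B ∈ H → side B ≤ k → ∀ {t₁ t₂} → t₁ < side B → t₂ < side B →
                    label k B t₁ ≡ label k B t₂ → t₁ ≡ t₂
  label-injective zero    B∈ side≤0 t₁<side _ _ = ⊥-elim (n≮0 (<-≤-trans t₁<side side≤0))
  label-injective (suc k) {B} B∈ side≤ {t₁} {t₂} t₁<side t₂<side eq
    with suc t₁ <? side B | suc t₂ <? side B
  ... | no t₁-last | no t₂-last = suc-injective (trans (last t₁<side t₁-last) (sym (last t₂<side t₂-last)))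
    where
    last : ∀ {t} → t < side B → ¬ suc t < side B → suc t ≡ side B
    last t<side not-below = ≤-antisym t<side (≮⇒≥ not-below)
  ... | yes q₁ | no _  = ⊥-elim (label-from-child≢B B∈ side≤ q₁ eq)
  ... | no _  | yes q₂ = ⊥-elim (label-from-child≢B B∈ side≤ q₂ (sym eq))
  ... | yes q₁ | yes q₂ with child B t₁ ≟B child B t₂
  ...   | no  C₁≢C₂ = ⊥-elim (children-labels-differ B∈ side≤ q₁ q₂ C₁≢C₂ eq)
  ...   | yes C₁≡C₂ =
    window-injective B∈ q₁ q₂ C₁≡C₂ (same-child C₁≡C₂ S₂.C∈ S₂.side-C≤k S₁.u<side S₂.u<side eq)
    where
    module S₁ = Step B∈ side≤ q₁
    module S₂ = Step B∈ side≤ q₂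
    -- Induction hypothesis, stated for two names of the same child.
    same-child : ∀ {C₁ C₂ u₁ u₂} → C₁ ≡ C₂ → C₂ ∈ H → side C₂ ≤ k → u₁ < side C₁ → u₂ < side C₂ →
                 label k C₁ u₁ ≡ label k C₂ u₂ → u₁ ≡ u₂
    same-child refl C∈ side≤k = label-injective k C∈ side≤k

  lower-bound : 1 ≤ m → m ≤ length H
  lower-bound 1≤m = injection-into-list H labelling (λ i → proj₁ (inside i)) labelling-injective
    where
    side-C≡m : side (cube₀ m) ≡ m
    side-C≡m = cube₀-side m
    below-side : ∀ (i : Fin m) → toℕ i < side (cube₀ m)
    below-side i = subst (toℕ i <_) (sym side-C≡m) (toℕ<n i)
    labelling : Fin m → Br
    labelling i = label m (cube₀ m) (toℕ i)
    inside : ∀ i → labelling i ∈ H × labelling i ⊑ cube₀ m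
    inside i = label-inside m (C∈H 1≤m) (≤-reflexive side-C≡m) (below-side i)
    labelling-injective : ∀ {i j} → labelling i ≡ labelling j → i ≡ j
    labelling-injective {i} {j} eq =
      toℕ-injective (label-injective m (C∈H 1≤m) (≤-reflexive side-C≡m) (below-side i) (below-side j) eq)

theorem2 : (d m : ℕ) → 1 ≤ d → 1 ≤ m → g'-is d m m
theorem2 zero    m () _
theorem2 (suc n) m _ 1≤m =
    (chain , chain-maximal , chain-length)
  , λ H (system , maximal) → LowerBound.lower-bound n m H system maximal 1≤m
  where open Chain n m
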